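{- Let $q$ be squarefree with all prime factors congruent to $-1\pmod 4$, and let $\psi:\mathbb{Z}_q\to\{ -1,+1\}$ satisfy $\psi(0)=1$ and $$\psi(x)\psi(y)\psi(z)=\psi\!\left(\frac{4xyz-x-y-z}{4(xy+yz+zx)-1}\right)\quad\text{for all }x,y,z\in\mathbb{Z}_q\text{ with }\gcd(4(xy+yz+zx)-1,q)=1.$$ Then $\psi(x)=1$ for every $x\in\mathbb{Z}_q$ such that $4x^2+1$ is a quadratic residue modulo $q$ (i.e. a square in $\mathbb{Z}_q$).
   Context: $\mathbb{Z}_q=\mathbb{Z}/q\mathbb{Z}$; the quotient means multiplication by the inverse in $\mathbb{Z}_q$. -}

module Defs where

open import Data.Nat as ℕ using (ℕ)
open import Data.Nat.Primality using (Prime)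
open import Data.Nat.Divisibility as ℕD using ()
open import Data.Integer using (ℤ; +_; _+_; _-_; _*_)
open import Data.Integer.Divisibility using () renaming (_∣_ to _∣ℤ_)
open import Data.Fin using (Fin; toℕ)
open import Data.Product using (∃)
open import Relation.Nullary using (¬_)
open import Relation.Binary.PropositionalEquality using (_≡_)

-- q squarefree: no square of a prime divides q (excludes q = 0)
Squarefree : ℕ → Set
Squarefree q = ∀ p → Prime p → ¬ ((p ℕ.* p) ℕD.∣ q)

AllPrimeFactors≡3mod4 : ℕ → Set
AllPrimeFactors≡3mod4 q = ∀ p → Prime p → p ℕD.∣ q → p ℕ.% 4 ≡ 3

-- elements of ℤ_q are represented by Fin q; ι gives the canonical integer representative
ι : ∀ {q} → Fin q → ℤ
ι x = + toℕ x

infix 4 _≡_[mod_]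
_≡_[mod_] : ℤ → ℤ → ℕ → Set
a ≡ b [mod q ] = (+ q) ∣ℤ (a - b)

num : ℤ → ℤ → ℤ → ℤ
num x y z = + 4 * x * y * z - x - y - z

den : ℤ → ℤ → ℤ → ℤ
den x y z = + 4 * (x * y + y * z + z * x) - + 1

IsSquareMod : ℕ → ℤ → Set
IsSquareMod q a = ∃ λ (t : Fin q) → ι t * ι t ≡ a [mod q ]

-- With z = 0 the functional equation reads ψ(y)² ψ(0) = ψ(-2y/(4y² - 1)), so it suffices to find y
-- with 4xy² + 2y - x = 0 and 4y² - 1 a unit.  As 4x² = (s + 1)(s - 1) where s² = 4x² + 1, the
-- value y = x/(s + 1) is a root.  Since s + 1 need not be a unit mod q, y is taken as x·v for a
-- quasi-inverse v of s + 1 (q ∣ (s + 1)(v(s + 1) - 1), available because q is squarefree), and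
-- everything is checked one prime p ∣ q at a time: either p ∣ s + 1, and then p ∣ 4x² forces
-- x ≡ y ≡ 0, or s + 1 is invertible mod p and y(s + 1) ≡ x.  Squarefreeness lifts the prime-wise
-- congruences back to q; of the hypothesis on the prime factors only the oddness of q is used.
module Submission where

open import Defs
open import Data.Nat using (ℕ)
open import Data.Nat.Coprimality using (Coprime)
open import Data.Integer using (ℤ; +_; _+_; _*_; ∣_∣)
open import Data.Fin using (Fin; toℕ)
open import Data.Sign using (Sign) renaming (_*_ to _·_)
open import Relation.Binary.PropositionalEquality using (_≡_)

open import Data.Nat as ℕ using (suc; NonZero)
import Data.Nat.Properties as ℕ
open import Data.Nat.Divisibility as ℕ using (divides)
open import Data.Nat.Coprimality using (coprime-Bézout; coprime⇒gcd≡1)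
open import Data.Nat.GCD using (gcd; gcd[m,n]∣m; gcd[m,n]∣n; gcd-greatest; module Bézout)
open import Data.Nat.LCM using (lcm; lcm-least; gcd*lcm)
open import Data.Nat.Primality using (Prime; euclidsLemma; irreducible[2]; prime[2]; prime⇒irreducible; ¬prime[1])
open import Data.Nat.Primality.Factorisation using (factorise)
open import Data.Nat.ListAction using (product)
open import Data.Integer using (_-_; -_)
import Data.Integer.Properties as ℤ
open import Data.Integer.Divisibility.Signed
open import Data.Integer.DivMod using (_%ℕ_; _/ℕ_; n%ℕd<d; a≡a%ℕn+[a/ℕn]*n)
open import Data.Integer.Tactic.RingSolver using (solve-∀)
open import Data.Fin using (zero; fromℕ<)
open import Data.Fin.Properties using (toℕ-fromℕ<)
open import Data.Sign.Properties using (s*s≡+)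
open import Data.List using ([]; _∷_)
open import Data.List.Relation.Unary.All using (All; []; _∷_)
open import Data.Product using (∃; _,_; _×_; proj₁; proj₂)
open import Data.Sum as Sum using (_⊎_; inj₁; inj₂; [_,_]′)
open import Data.Empty using (⊥; ⊥-elim)
open import Relation.Nullary using (¬_; contradiction)
open import Relation.Binary.PropositionalEquality using (refl; sym; trans; cong; cong₂; subst; module ≡-Reasoning)

open ≡-Reasoning

prime∣2⇒≡2 : ∀ {p} → Prime p → p ℕ.∣ 2 → p ≡ 2
prime∣2⇒≡2 pr p∣2 = [ (λ { refl → contradiction pr ¬prime[1] }) , (λ p≡2 → p≡2) ]′ (irreducible[2] p∣2)

∃-prime-divisor : ∀ n → .{{_ : ℕ.NonTrivial n}} → ∃ λ p → Prime p × p ℕ.∣ n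
∃-prime-divisor n@(suc (suc _)) with factorise n
... | record { factors = p ∷ ps ; isFactorisation = eq ; factorsPrime = pr ∷ _ } =
  p , pr , subst (p ℕ.∣_) (sym eq) (ℕ.m∣m*n (product ps))

¬common-prime⇒coprime : ∀ {m n} → .{{_ : NonZero n}} →
  (∀ {p} → Prime p → p ℕ.∣ m → p ℕ.∣ n → ⊥) → Coprime m n
¬common-prime⇒coprime {n = n} _ {0} (_ , 0∣n) = contradiction (ℕ.0∣⇒≡0 0∣n) (ℕ.≢-nonZero⁻¹ n)
¬common-prime⇒coprime _ {1} _ = refl
¬common-prime⇒coprime no-common {i@(suc (suc _))} (i∣m , i∣n) with ∃-prime-divisor i
... | p , pr , p∣i = ⊥-elim (no-common pr (ℕ.∣-trans p∣i i∣m) (ℕ.∣-trans p∣i i∣n))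

coprime⇒*∣ : ∀ {m n o} → Coprime m n → m ℕ.∣ o → n ℕ.∣ o → m ℕ.* n ℕ.∣ o
coprime⇒*∣ {m} {n} {o} m⊥n m∣o n∣o = subst (ℕ._∣ o) lcm≡* (lcm-least m∣o n∣o)
  where
  lcm≡* : lcm m n ≡ m ℕ.* n
  lcm≡* = trans (sym (ℕ.*-identityˡ (lcm m n)))
            (trans (cong (ℕ._* lcm m n) (sym (coprime⇒gcd≡1 m⊥n))) (gcd*lcm m n))

prime∤⇒coprime : ∀ {p n} → Prime p → ¬ p ℕ.∣ n → Coprime p n
prime∤⇒coprime pr p∤n (i∣p , i∣n) =
  [ (λ i≡1 → i≡1) , (λ { refl → contradiction i∣n p∤n }) ]′ (prime⇒irreducible pr i∣p)

squarefree-∣ : ∀ {q n} → .{{_ : NonZero q}} → Squarefree q →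
  (∀ p → Prime p → p ℕ.∣ q → p ℕ.∣ n) → q ℕ.∣ n
squarefree-∣ {q} {n} sq primes∣n with factorise q
... | record { factors = ps ; isFactorisation = eq ; factorsPrime = prs } =
  subst (ℕ._∣ n) (sym eq) (product∣ prs (subst Squarefree eq sq)
    (λ p pr p∣ps → primes∣n p pr (subst (p ℕ.∣_) (sym eq) p∣ps)))
  where
  product∣ : ∀ {ps} → All Prime ps → Squarefree (product ps) →
    (∀ p → Prime p → p ℕ.∣ product ps → p ℕ.∣ n) → product ps ℕ.∣ n
  product∣ [] _ _ = ℕ.1∣ n
  product∣ {p ∷ ps} (pr ∷ prs) sq primes∣n =
    coprime⇒*∣ (prime∤⇒coprime pr (λ p∣r → sq p pr (ℕ.*-monoʳ-∣ p p∣r)))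
      (primes∣n p pr (ℕ.m∣m*n (product ps)))
      (product∣ prs (λ d dp dd∣r → sq d dp (ℕ.∣-trans dd∣r (ℕ.n∣m*n p)))
        (λ d dp d∣r → primes∣n d dp (ℕ.∣-trans d∣r (ℕ.n∣m*n p))))

coprime⇒inverse : ∀ {a h} → Coprime a h → ∃ λ v → + h ∣ v * + a - + 1
coprime⇒inverse {a} {h} a⊥h = fromBézout (coprime-Bézout a⊥h)
  where
  toℤ-identity : ∀ {k l m n} → 1 ℕ.+ k ℕ.* l ≡ m ℕ.* n → + 1 + + k * + l ≡ + m * + n
  toℤ-identity {k} {l} {m} {n} eq =
    trans (cong (_+_ (+ 1)) (sym (ℤ.pos-* k l))) (trans (cong +_ eq) (ℤ.pos-* m n))
  1+u-1≡u : ∀ u → + 1 + u - + 1 ≡ u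
  1+u-1≡u = solve-∀
  -x*a-1≡-[1+x*a] : ∀ x a → (- x) * a - + 1 ≡ - (+ 1 + x * a)
  -x*a-1≡-[1+x*a] = solve-∀
  fromBézout : Bézout.Identity 1 a h → ∃ λ v → + h ∣ v * + a - + 1
  fromBézout (Bézout.+- x y eq) = + x , divides (+ y) (begin
    + x * + a - + 1         ≡⟨ cong (_- + 1) (sym (toℤ-identity {y} {h} {x} {a} eq)) ⟩
    + 1 + + y * + h - + 1   ≡⟨ 1+u-1≡u (+ y * + h) ⟩
    + y * + h               ∎)
  fromBézout (Bézout.-+ x y eq) = - + x , divides (- + y) (begin
    (- + x) * + a - + 1     ≡⟨ -x*a-1≡-[1+x*a] (+ x) (+ a) ⟩
    - (+ 1 + + x * + a)     ≡⟨ cong -_ (toℤ-identity {x} {a} {y} {h} eq) ⟩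
    - (+ y * + h)           ≡⟨ ℤ.neg-distribˡ-* (+ y) (+ h) ⟩
    (- + y) * + h           ∎)

squarefree⇒quasiInverse : ∀ {q} → .{{_ : NonZero q}} → Squarefree q →
  ∀ a → ∃ λ v → + q ∣ + a * (v * + a - + 1)
squarefree⇒quasiInverse {q} {{q≢0}} sq a = fromGcd∣ (gcd[m,n]∣n a q)
  where
  g : ℕ
  g = gcd a q
  fromGcd∣ : g ℕ.∣ q → ∃ λ v → + q ∣ + a * (v * + a - + 1)
  fromGcd∣ (divides h q≡h*g) = v , ∣ᵤ⇒∣ (subst (ℕ._∣ ∣ + a * w ∣) (sym q≡h*g)
      (subst (h ℕ.* g ℕ.∣_) (trans (ℕ.*-comm ∣ w ∣ a) (sym (ℤ.abs-* (+ a) w)))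
        (ℕ.*-pres-∣ (∣⇒∣ᵤ h∣va-1) (gcd[m,n]∣m a q))))
    where
    h∣q : h ℕ.∣ q
    h∣q = subst (h ℕ.∣_) (sym q≡h*g) (ℕ.m∣m*n g)
    a⊥h : Coprime a h
    a⊥h = ¬common-prime⇒coprime {{ℕ.m*n≢0⇒m≢0 h {{subst NonZero q≡h*g q≢0}}}} λ {p} pr p∣a p∣h →
      sq p pr (subst (p ℕ.* p ℕ.∣_) (sym q≡h*g)
        (ℕ.*-pres-∣ p∣h (gcd-greatest p∣a (ℕ.∣-trans p∣h h∣q))))
    v : ℤ
    v = proj₁ (coprime⇒inverse a⊥h)
    w : ℤ
    w = v * + a - + 1
    h∣va-1 : + h ∣ w
    h∣va-1 = proj₂ (coprime⇒inverse a⊥h)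

euclidsLemmaℤ : ∀ m n {p} → Prime p → + p ∣ m * n → (+ p ∣ m) ⊎ (+ p ∣ n)
euclidsLemmaℤ m n pr p∣mn =
  Sum.map ∣ᵤ⇒∣ ∣ᵤ⇒∣ (euclidsLemma ∣ m ∣ ∣ n ∣ pr (subst (_ ℕ.∣_) (ℤ.abs-* m n) (∣⇒∣ᵤ p∣mn)))

module _ {p : ℕ} (prime : Prime p) where

  ∤1 : ¬ + p ∣ + 1
  ∤1 p∣1 = ¬prime[1] (subst Prime (ℕ.∣1⇒≡1 (∣⇒∣ᵤ p∣1)) prime)

  ∤m∧∣m*n⇒∣n : ∀ {m n} → ¬ + p ∣ m → + p ∣ m * n → + p ∣ n
  ∤m∧∣m*n⇒∣n {m} {n} p∤m p∣mn =
    [ (λ p∣m → contradiction p∣m p∤m) , (λ p∣n → p∣n) ]′ (euclidsLemmaℤ m n prime p∣mn)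

  ∣4*m*m⇒∣m : ∀ {m} → ¬ + p ∣ + 2 → + p ∣ + 4 * m * m → + p ∣ m
  ∣4*m*m⇒∣m {m} p∤2 p∣4mm = Sum.reduce (euclidsLemmaℤ m m prime
    (∤m∧∣m*n⇒∣n p∤2 (∤m∧∣m*n⇒∣n p∤2 (subst (+ p ∣_) (4*m*m≡2*[2*[m*m]] m) p∣4mm))))
    where
    4*m*m≡2*[2*[m*m]] : ∀ m → + 4 * m * m ≡ + 2 * (+ 2 * (m * m))
    4*m*m≡2*[2*[m*m]] = solve-∀

  preimage-mod-prime : ∀ {X S Y} → ¬ + p ∣ + 2 → + p ∣ S * S - (+ 4 * X * X + + 1) →
    ((+ p ∣ X) × (+ p ∣ Y)) ⊎ ((¬ + p ∣ S + + 1) × (+ p ∣ (S + + 1) * Y - X)) →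
    (+ p ∣ (+ 4 * (Y * Y) - + 1) * X + + 2 * Y) × (¬ + p ∣ + 4 * (Y * Y) - + 1)
  preimage-mod-prime {X} {S} {Y} p∤2 p∣E (inj₁ (p∣X , p∣Y)) =
    ∣m∣n⇒∣m+n (∣n⇒∣m*n (+ 4 * (Y * Y) - + 1) p∣X) (∣n⇒∣m*n (+ 2) p∣Y) ,
    λ p∣D → ∤1 (subst (+ p ∣_) (1≡y*4y-D Y) (∣m∣n⇒∣m-n (∣m⇒∣m*n _ p∣Y) p∣D))
    where
    1≡y*4y-D : ∀ y → y * (+ 4 * y) - (+ 4 * (y * y) - + 1) ≡ + 1
    1≡y*4y-D = solve-∀
  preimage-mod-prime {X} {S} {Y} p∤2 p∣E (inj₂ (p∤a , p∣W)) =
    ∤m∧∣m*n⇒∣n p∤a (subst (+ p ∣_) (a*N≡ X S Y) (∣m∣n⇒∣m-n (∣m⇒∣m*n _ p∣W) (∣n⇒∣m*n Y p∣E))) ,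
    λ p∣D → [ p∤2 , p∤a ]′ (euclidsLemmaℤ (+ 2) (S + + 1) prime (subst (+ p ∣_) (2*a≡ X S Y)
      (∣m∣n⇒∣m-n (∣m∣n⇒∣m-n (∣m⇒∣m*n _ p∣W) p∣E) (∣n⇒∣m*n ((S + + 1) * (S + + 1)) p∣D))))
    where
    a*N≡ : ∀ X S Y → ((S + + 1) * Y - X)
                        * (+ 4 * Y * (X + (S + + 1) * Y) - (S + + 1) * (+ 4 * (Y * Y) - + 1))
                      - Y * (S * S - (+ 4 * X * X + + 1))
                      ≡ (S + + 1) * ((+ 4 * (Y * Y) - + 1) * X + + 2 * Y)
    a*N≡ = solve-∀
    2*a≡ : ∀ X S Y → ((S + + 1) * Y - X) * (+ 4 * ((S + + 1) * Y + X)) - (S * S - (+ 4 * X * X + + 1))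
                      - (S + + 1) * (S + + 1) * (+ 4 * (Y * Y) - + 1)
                      ≡ + 2 * (S + + 1)
    2*a≡ = solve-∀

  preimage-cases-mod-prime : ∀ {X S V Y} → ¬ + p ∣ + 2 → + p ∣ S * S - (+ 4 * X * X + + 1) →
    + p ∣ (S + + 1) * (V * (S + + 1) - + 1) → + p ∣ Y - X * V →
    ((+ p ∣ X) × (+ p ∣ Y)) ⊎ ((¬ + p ∣ S + + 1) × (+ p ∣ (S + + 1) * Y - X))
  preimage-cases-mod-prime {X} {S} {V} {Y} p∤2 p∣E p∣a[va-1] p∣F =
    Sum.map when-p∣a when-p∣va-1 (euclidsLemmaℤ (S + + 1) _ prime p∣a[va-1])
    where
    when-p∣a : + p ∣ S + + 1 → (+ p ∣ X) × (+ p ∣ Y)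
    when-p∣a p∣a = p∣X , subst (+ p ∣_) (y≡ X V Y) (∣m∣n⇒∣m+n p∣F (∣m⇒∣m*n V p∣X))
      where
      4*x*x≡ : ∀ X S → (S + + 1) * (S - + 1) - (S * S - (+ 4 * X * X + + 1)) ≡ + 4 * X * X
      4*x*x≡ = solve-∀
      y≡ : ∀ X V Y → (Y - X * V) + X * V ≡ Y
      y≡ = solve-∀
      p∣X : + p ∣ X
      p∣X = ∣4*m*m⇒∣m p∤2 (subst (+ p ∣_) (4*x*x≡ X S) (∣m∣n⇒∣m-n (∣m⇒∣m*n (S - + 1) p∣a) p∣E))
    when-p∣va-1 : + p ∣ V * (S + + 1) - + 1 → (¬ + p ∣ S + + 1) × (+ p ∣ (S + + 1) * Y - X)
    when-p∣va-1 p∣va-1 =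
      (λ p∣a → ∤1 (subst (+ p ∣_) (1≡ V (S + + 1)) (∣m∣n⇒∣m-n (∣n⇒∣m*n V p∣a) p∣va-1))) ,
      subst (+ p ∣_) (w≡ X S V Y) (∣m∣n⇒∣m+n (∣n⇒∣m*n (S + + 1) p∣F) (∣n⇒∣m*n X p∣va-1))
      where
      1≡ : ∀ V A → V * A - (V * A - + 1) ≡ + 1
      1≡ = solve-∀
      w≡ : ∀ X S V Y → (S + + 1) * (Y - X * V) + X * (V * (S + + 1) - + 1) ≡ (S + + 1) * Y - X
      w≡ = solve-∀

∃-representative : ∀ q → .{{_ : NonZero q}} → (z : ℤ) → ∃ λ (y : Fin q) → + q ∣ ι y - z
∃-representative q z = fromℕ< r<q , divides (- (z /ℕ q)) (begin
  ι (fromℕ< r<q) - z                          ≡⟨ cong (λ r → + r - z) (toℕ-fromℕ< r<q) ⟩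
  + (z %ℕ q) - z                              ≡⟨ cong (λ w → + (z %ℕ q) - w) (a≡a%ℕn+[a/ℕn]*n z q) ⟩
  + (z %ℕ q) - (+ (z %ℕ q) + (z /ℕ q) * + q)  ≡⟨ r-[r+k*q]≡-k*q (+ (z %ℕ q)) (z /ℕ q) (+ q) ⟩
  - (z /ℕ q) * + q                            ∎)
  where
  r<q : z %ℕ q ℕ.< q
  r<q = n%ℕd<d z q
  r-[r+k*q]≡-k*q : ∀ r k q → r - (r + k * q) ≡ - k * q
  r-[r+k*q]≡-k*q = solve-∀

den[y,y,0] : ∀ y → den y y (+ 0) ≡ + 4 * (y * y) - + 1
den[y,y,0] = identity
  where
  identity : ∀ y → + 4 * (y * y + y * + 0 + + 0 * y) - + 1 ≡ + 4 * (y * y) - + 1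
  identity = solve-∀

den[y,y,0]*x-num[y,y,0] : ∀ x y →
  den y y (+ 0) * x - num y y (+ 0) ≡ (+ 4 * (y * y) - + 1) * x + + 2 * y
den[y,y,0]*x-num[y,y,0] = identity
  where
  identity : ∀ x y → (+ 4 * (y * y + y * + 0 + + 0 * y) - + 1) * x - (+ 4 * y * y * + 0 - y - y - + 0)
                     ≡ (+ 4 * (y * y) - + 1) * x + + 2 * y
  identity = solve-∀

∃-preimage[y,y,0] : ∀ {q} → .{{_ : NonZero q}} → Squarefree q → ¬ 2 ℕ.∣ q →
  ∀ X s → + q ∣ + s * + s - (+ 4 * X * X + + 1) →
  ∃ λ (y : Fin q) → Coprime ∣ den (ι y) (ι y) (+ 0) ∣ q ×
                    den (ι y) (ι y) (+ 0) * X ≡ num (ι y) (ι y) (+ 0) [mod q ]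
∃-preimage[y,y,0] {q} sq 2∤q X s q∣s²-[4X²+1] =
  y , den-coprime , ∣⇒∣ᵤ (subst (+ q ∣_) (sym (den[y,y,0]*x-num[y,y,0] X (ι y))) q∣N)
  where
  v : ℤ
  v = proj₁ (squarefree⇒quasiInverse sq (s ℕ.+ 1))
  q∣[s+1][v[s+1]-1] : + q ∣ (+ s + + 1) * (v * (+ s + + 1) - + 1)
  q∣[s+1][v[s+1]-1] = proj₂ (squarefree⇒quasiInverse sq (s ℕ.+ 1))
  y : Fin q
  y = proj₁ (∃-representative q (X * v))
  q∣y-Xv : + q ∣ ι y - X * v
  q∣y-Xv = proj₂ (∃-representative q (X * v))
  preimage-at : ∀ {p} → Prime p → p ℕ.∣ q →
    (+ p ∣ (+ 4 * (ι y * ι y) - + 1) * X + + 2 * ι y) × (¬ + p ∣ + 4 * (ι y * ι y) - + 1)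
  preimage-at pr p∣q = preimage-mod-prime pr {X} {+ s} {ι y} p∤2 (p∣ q∣s²-[4X²+1])
    (preimage-cases-mod-prime pr {X} {+ s} {v} {ι y} p∤2 (p∣ q∣s²-[4X²+1])
      (p∣ q∣[s+1][v[s+1]-1]) (p∣ q∣y-Xv))
    where
    p∣ : ∀ {z} → + q ∣ z → + _ ∣ z
    p∣ = ∣-trans (∣ᵤ⇒∣ p∣q)
    p∤2 : ¬ + _ ∣ + 2
    p∤2 p∣2 with prime∣2⇒≡2 pr (∣⇒∣ᵤ p∣2)
    ... | refl = 2∤q p∣q
  q∣N : + q ∣ (+ 4 * (ι y * ι y) - + 1) * X + + 2 * ι y
  q∣N = ∣ᵤ⇒∣ (squarefree-∣ sq λ p pr p∣q → ∣⇒∣ᵤ (proj₁ (preimage-at pr p∣q)))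
  den-coprime : Coprime ∣ den (ι y) (ι y) (+ 0) ∣ q
  den-coprime = ¬common-prime⇒coprime λ pr p∣den p∣q →
    proj₂ (preimage-at pr p∣q) (subst (+ _ ∣_) (den[y,y,0] (ι y)) (∣ᵤ⇒∣ p∣den))

lemma7p10 : (q : ℕ) → Squarefree q → AllPrimeFactors≡3mod4 q →
    (ψ : Fin q → Sign) →
    (∀ (o : Fin q) → toℕ o ≡ 0 → ψ o ≡ Sign.+) →
    (∀ (x y z w : Fin q) → Coprime ∣ den (ι x) (ι y) (ι z) ∣ q →
      den (ι x) (ι y) (ι z) * ι w ≡ num (ι x) (ι y) (ι z) [mod q ] →
      (ψ x · ψ y) · ψ z ≡ ψ w) →
    ∀ (x : Fin q) → IsSquareMod q (+ 4 * ι x * ι x + + 1) → ψ x ≡ Sign.+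
lemma7p10 ℕ.zero _ _ _ _ _ ()
lemma7p10 q@(suc _) sq ≡3mod4 ψ ψ0≡+ ψ-law x (t , t²≡4x²+1) =
  let y , den-coprime , x-is-image = ∃-preimage[y,y,0] sq 2∤q (ι x) (toℕ t) (∣ᵤ⇒∣ t²≡4x²+1)
  in begin
    ψ x                   ≡⟨ sym (ψ-law y y zero x den-coprime x-is-image) ⟩
    (ψ y · ψ y) · ψ zero  ≡⟨ cong₂ _·_ (s*s≡+ (ψ y)) (ψ0≡+ zero refl) ⟩
    Sign.+                ∎
  where
  2∤q : ¬ 2 ℕ.∣ q
  2∤q 2∣q with () ← ≡3mod4 2 prime[2] 2∣q
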